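{- Let $N\ge2$ be an integer, $\overline k\in\mathbb{Z}/N\mathbb{Z}$, and let $n$ be the size of the $\overline k$-monomial minimal solution of $(E_N)$. (A) Let $m$ be a natural number. (i) If a tuple $(\overline a,\overline k,\dots,\overline k,\overline b)\in(\mathbb{Z}/N\mathbb{Z})^{nm}$ (all entries other than the first and last equal to $\overline k$) is a solution of $(E_N)$, then $\overline a=\overline b=\overline k$. (ii) There is no solution of $(E_N)$ of the form $(\overline a,\overline k,\dots,\overline k,\overline b)$ of size $nm+1$. (iii) If $(\overline a,\overline k,\dots,\overline k,\overline b)\in(\mathbb{Z}/N\mathbb{Z})^{nm+2}$ is a solution of $(E_N)$, then $\overline a=\overline b=\overline 0$. (B) Suppose the $\overline k$-monomial minimal solution of $(E_N)$ is irreducible. Then $(\overline a,\overline k,\dots,\overline k,\overline a)\in(\mathbb{Z}/N\mathbb{Z})^l$ is a solution of $(E_N)$ if and only if one of the following holds: $l\equiv 0 \pmod n$ and $\overline a=\overline k$; or $l\equiv 2\pmod n$ and $\overline a=\overline 0$.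
   Context: For an integer $N\ge 2$ and $a_1,\dots,a_n\in\mathbb{Z}/N\mathbb{Z}$, set $M_n(a_1,\dots,a_n)=\begin{pmatrix}a_n&-1\\1&0\end{pmatrix}\cdots\begin{pmatrix}a_1&-1\\1&0\end{pmatrix}\in SL_2(\mathbb{Z}/N\mathbb{Z})$. The equation $(E_N)$ is $M_n(a_1,\dots,a_n)=\pm \mathrm{Id}$; an $n$-tuple satisfying it is a solution of size $n$. Define $(a_1,\dots,a_n)\oplus(b_1,\dots,b_m)=(a_1+b_m,a_2,\dots,a_{n-1},a_n+b_1,b_2,\dots,b_{m-1})$, and $(a_1,\dots,a_n)\sim(b_1,\dots,b_n)$ if $(b_1,\dots,b_n)$ is a cyclic permutation of $(a_1,\dots,a_n)$ or of $(a_n,\dots,a_1)$. A solution $(c_1,\dots,c_n)$ of $(E_N)$ with $n\ge 3$ is reducible if there exist a solution $(b_1,\dots,b_l)$ of $(E_N)$ and an $m$-tuple $(a_1,\dots,a_m)$ with $m\ge3$, $l\ge 3$ and $(c_1,\dots,c_n)\sim(a_1,\dots,a_m)\oplus(b_1,\dots,b_l)$; otherwise irreducible ($(\overline0,\overline0)$ is not irreducible). The $\overline k$-monomial minimal solution of $(E_N)$ is $(\overline k,\dots,\overline k)$ of the least positive length $n$ for which it solves $(E_N)$. -}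

module Defs where

open import Data.Nat using (ℕ; zero; suc)
open import Data.Integer using (ℤ; +_; _+_; _*_; _-_; -_)
open import Data.Integer.Divisibility using (_∣_)
open import Data.List using (List; []; _∷_; _++_; foldl; length; drop; take; reverse; replicate)
open import Data.List.Relation.Binary.Pointwise using (Pointwise)
open import Data.Product using (_×_; _,_; ∃; Σ)
open import Data.Sum using (_⊎_)
open import Relation.Nullary using (¬_)
open import Relation.Binary.PropositionalEquality using (_≡_)
import Data.Nat as ℕ

-- Elements of Z/NZ are represented by integers; equality in Z/NZ is
-- congruence modulo N.
infix 4 _≡[_]_
_≡[_]_ : ℤ → ℕ → ℤ → Set
x ≡[ N ] y = (+ N) ∣ (x - y)

record Mat : Set where
  constructor mat
  field
    m11 m12 m21 m22 : ℤ

_⊗_ : Mat → Mat → Mat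
mat a b c d ⊗ mat e f g h = mat (a * e + b * g) (a * f + b * h) (c * e + d * g) (c * f + d * h)

IdM : Mat
IdM = mat (+ 1) (+ 0) (+ 0) (+ 1)

T : ℤ → Mat
T a = mat a (- (+ 1)) (+ 1) (+ 0)

-- M_n(a_1,...,a_n) = T(a_n) ... T(a_1)
M : List ℤ → Mat
M = foldl (λ acc a → T a ⊗ acc) IdM

_≈M[_]_ : Mat → ℕ → Mat → Set
mat a b c d ≈M[ N ] mat e f g h =
  (a ≡[ N ] e) × (b ≡[ N ] f) × (c ≡[ N ] g) × (d ≡[ N ] h)

NegId : Mat
NegId = mat (- (+ 1)) (+ 0) (+ 0) (- (+ 1))

-- the tuple is a solution of (E_N): M_n = ± Id in SL_2(Z/NZ)
Sol : ℕ → List ℤ → Set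
Sol N as = (M as ≈M[ N ] IdM) ⊎ (M as ≈M[ N ] NegId)

IsMonoMinSize : ℕ → ℤ → ℕ → Set
IsMonoMinSize N k n =
  (1 ℕ.≤ n) × Sol N (replicate n k) × (∀ j → 1 ℕ.≤ j → j ℕ.< n → ¬ Sol N (replicate j k))

initLast : ℤ → List ℤ → List ℤ × ℤ
initLast x [] = [] , x
initLast x (y ∷ ys) with initLast y ys
... | i , l = x ∷ i , l

-- (a_1..a_n) ⊕ (b_1..b_m) = (a_1+b_m, a_2..a_{n-1}, a_n+b_1, b_2..b_{m-1})
-- (only used for n, m ≥ 3; junk value otherwise)
_⊕_ : List ℤ → List ℤ → List ℤ
(a1 ∷ a2 ∷ as) ⊕ (b1 ∷ b2 ∷ bs) with initLast a2 as | initLast b2 bs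
... | amid , an | bmid , bm = (a1 + bm) ∷ (amid ++ ((an + b1) ∷ bmid))
_ ⊕ _ = []

_≈L[_]_ : List ℤ → ℕ → List ℤ → Set
xs ≈L[ N ] ys = Pointwise (λ x y → x ≡[ N ] y) xs ys

rotate : ℕ → List ℤ → List ℤ
rotate i xs = drop i xs ++ take i xs

Equiv : ℕ → List ℤ → List ℤ → Set
Equiv N as bs = ∃ λ i → (bs ≈L[ N ] rotate i as) ⊎ (bs ≈L[ N ] rotate i (reverse as))

Reducible : ℕ → List ℤ → Set
Reducible N cs = Σ (List ℤ) λ bs → Σ (List ℤ) λ as →
  Sol N bs × 3 ℕ.≤ length as × 3 ℕ.≤ length bs × Equiv N (as ⊕ bs) cs

-- irreducible solution: a solution of size ≥ 3 which is not reducible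
-- (size-2 solution (0,0) is not irreducible; no solutions of size < 2 exist)
Irreducible : ℕ → List ℤ → Set
Irreducible N cs = Sol N cs × 3 ℕ.≤ length cs × ¬ Reducible N cs

tup : ℤ → ℤ → ℕ → ℤ → List ℤ
tup a k j b = a ∷ (replicate j k ++ (b ∷ []))

{-# OPTIONS --safe #-}
module Submission where

-- The tuple (a, k, …, k, b) with j middle entries has matrix T(b) T(k)^j T(a), and T(k)^n ≡ ±Id
-- (mod N). Since ±Id is central, a factor ≡ ±Id may be removed from the middle of a product without
-- changing whether the product is ≡ ±Id. Writing T(b) = E₁₂(b − k) T(k) and T(a) = T(k) E₂₁(k − a),
-- a solution of size nm thus yields E₁₂(b − k) E₂₁(k − a) ≡ ±Id, one of size nm + 1 yields
-- T(b) E₂₁(k − a) ≡ ±Id, impossible as its (2,1) entry is 1, and one of size nm + 2 yields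
-- T(b) T(a) ≡ ±Id; the off-diagonal entries give (A). For (B), a symmetric solution whose size is
-- r mod n with 3 ≤ r < n shortens to a symmetric solution (a, k, …, k, a) of size r, and then the
-- monomial solution of size n is (k − a, k, …, k, k − a) ⊕ (a, k, …, k, a), hence reducible.

open import Defs
open import Algebra.Bundles using (Monoid)
open import Data.Empty using (⊥-elim)
open import Data.Integer using (ℤ; +_)
import Data.Integer.Divisibility.Signed as Signed
open import Data.Integer.Tactic.RingSolver using (solve-∀)
open import Data.List using ([]; _∷_; _++_; foldl; replicate; length)
open import Data.List.Properties using (foldl-++; ++-identityʳ)
open import Data.List.Relation.Binary.Pointwise using (≡⇒Pointwise-≡; map)
open import Data.Nat as ℕ using (ℕ; zero; suc; _≤_; _<_; s≤s; z≤n; NonZero; >-nonZero)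
import Data.Nat.Divisibility as ℕ
open import Data.Nat.DivMod using (_%_; _/_; m≡m%n+[m/n]*n; m%n<n)
import Data.Nat.Properties as ℕ
open import Data.Nat.Properties using (+-cancelʳ-≡; +-suc; +-comm; *-comm; m≤n⇒∃[o]m+o≡n)
import Data.Nat.Tactic.RingSolver as ℕ-Solver
open import Data.Product using (_×_; _,_; ∃; proj₁; proj₂)
import Data.Product as Product
open import Data.Sum using (_⊎_; inj₁; inj₂)
import Data.Sum as Sum
open import Function.Bundles using (_⇔_; mk⇔; Equivalence)
open import Function.Properties.Equivalence using (⇔-setoid)
open import Level using (0ℓ)
open import Relation.Binary.Bundles using (Setoid)
open import Relation.Binary.PropositionalEquality
import Relation.Binary.Reasoning.Setoid as SetoidReasoning
open import Relation.Nullary using (¬_)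
open Equivalence using (to; from)

replicate-+ : ∀ {A : Set} p q (x : A) → replicate (p ℕ.+ q) x ≡ replicate p x ++ replicate q x
replicate-+ zero q x = refl
replicate-+ (suc p) q x = cong (x ∷_) (replicate-+ p q x)

replicate-tup : ∀ k j → replicate (j ℕ.+ 2) k ≡ tup k k j k
replicate-tup k zero = refl
replicate-tup k (suc j) = cong (k ∷_) (replicate-tup k j)

module IntegerMatrices where
  open import Data.Integer using (_+_; _*_; _-_; -_)

  mat-cong : ∀ {a b c d e f g h} → a ≡ e → b ≡ f → c ≡ g → d ≡ h → mat a b c d ≡ mat e f g h
  mat-cong refl refl refl refl = refl

  ⊗-assoc : ∀ X Y Z → (X ⊗ Y) ⊗ Z ≡ X ⊗ (Y ⊗ Z)
  ⊗-assoc (mat a b c d) (mat e f g h) (mat p q r s) =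
    mat-cong (row a b e f g h p r) (row a b e f g h q s) (row c d e f g h p r) (row c d e f g h q s)
    where
    row : ∀ x₁ x₂ e f g h z₁ z₂ → (x₁ * e + x₂ * g) * z₁ + (x₁ * f + x₂ * h) * z₂
                                ≡ x₁ * (e * z₁ + f * z₂) + x₂ * (g * z₁ + h * z₂)
    row = solve-∀

  ⊗-identityˡ : ∀ X → IdM ⊗ X ≡ X
  ⊗-identityˡ (mat a b c d) = mat-cong (first a c) (first b d) (second a c) (second b d)
    where
    first : ∀ x y → + 1 * x + + 0 * y ≡ x
    first = solve-∀
    second : ∀ x y → + 0 * x + + 1 * y ≡ y
    second = solve-∀

  ⊗-identityʳ : ∀ X → X ⊗ IdM ≡ X
  ⊗-identityʳ (mat a b c d) = mat-cong (first a b) (second a b) (first c d) (second c d)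
    where
    first : ∀ x y → x * + 1 + y * + 0 ≡ x
    first = solve-∀
    second : ∀ x y → x * + 0 + y * + 1 ≡ y
    second = solve-∀

  ⊗-monoid : Monoid _ _
  ⊗-monoid = record
    { isMonoid = record
      { isSemigroup = record
        { isMagma = record { isEquivalence = isEquivalence ; ∙-cong = cong₂ _⊗_ }
        ; assoc = ⊗-assoc
        }
      ; identity = ⊗-identityˡ , ⊗-identityʳ
      }
    }

  open import Algebra.Solver.Monoid ⊗-monoid public using (solve; _⊜_; id) renaming (_⊕_ to _∙_)

  IdM-central : ∀ X → X ⊗ IdM ≡ IdM ⊗ X
  IdM-central X = trans (⊗-identityʳ X) (sym (⊗-identityˡ X))

  NegId-central : ∀ X → X ⊗ NegId ≡ NegId ⊗ X
  NegId-central (mat a b c d) =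
    trans (mat-cong (right₁ a b) (right₂ a b) (right₁ c d) (right₂ c d))
          (sym (mat-cong (left₁ a c) (left₁ b d) (left₂ a c) (left₂ b d)))
    where
    right₁ : ∀ x y → x * - + 1 + y * + 0 ≡ - x
    right₁ = solve-∀
    right₂ : ∀ x y → x * + 0 + y * - + 1 ≡ - y
    right₂ = solve-∀
    left₁ : ∀ x y → - + 1 * x + + 0 * y ≡ - x
    left₁ = solve-∀
    left₂ : ∀ x y → + 0 * x + - + 1 * y ≡ - y
    left₂ = solve-∀

  E₁₂ E₂₁ : ℤ → Mat
  E₁₂ s = mat (+ 1) s (+ 0) (+ 1)
  E₂₁ s = mat (+ 1) (+ 0) s (+ 1)

  T≡E₁₂⊗T : ∀ b k → T b ≡ E₁₂ (b - k) ⊗ T k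
  T≡E₁₂⊗T b k = mat-cong (e₁₁ b k) (e₁₂ (b - k)) refl refl
    where
    e₁₁ : ∀ b k → b ≡ + 1 * k + (b - k) * + 1
    e₁₁ = solve-∀
    e₁₂ : ∀ s → - + 1 ≡ + 1 * - + 1 + s * + 0
    e₁₂ = solve-∀

  T≡T⊗E₂₁ : ∀ a k → T a ≡ T k ⊗ E₂₁ (k - a)
  T≡T⊗E₂₁ a k = mat-cong (e₁₁ a k) (e₁₂ k) refl refl
    where
    e₁₁ : ∀ a k → a ≡ k * + 1 + - + 1 * (k - a)
    e₁₁ = solve-∀
    e₁₂ : ∀ k → - + 1 ≡ k * + 0 + - + 1 * + 1
    e₁₂ = solve-∀

  E₁₂⊗E₂₁ : ∀ s t → E₁₂ s ⊗ E₂₁ t ≡ mat (+ 1 + s * t) s t (+ 1)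
  E₁₂⊗E₂₁ s t = mat-cong refl (e₁₂ s) (e₂₁ t) refl
    where
    e₁₂ : ∀ s → + 1 * + 0 + s * + 1 ≡ s
    e₁₂ = solve-∀
    e₂₁ : ∀ t → + 0 * + 1 + + 1 * t ≡ t
    e₂₁ = solve-∀

  T⊗E₂₁ : ∀ b t → T b ⊗ E₂₁ t ≡ mat (b - t) (- + 1) (+ 1) (+ 0)
  T⊗E₂₁ b t = mat-cong (e₁₁ b t) (e₁₂ b) refl refl
    where
    e₁₁ : ∀ b t → b * + 1 + - + 1 * t ≡ b - t
    e₁₁ = solve-∀
    e₁₂ : ∀ b → b * + 0 + - + 1 * + 1 ≡ - + 1
    e₁₂ = solve-∀

  T⊗T : ∀ b a → T b ⊗ T a ≡ mat (b * a - + 1) (- b) a (- + 1)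
  T⊗T b a = mat-cong (e₁₁ b a) (e₁₂ b) (e₂₁ a) refl
    where
    e₁₁ : ∀ b a → b * a + - + 1 * + 1 ≡ b * a - + 1
    e₁₁ = solve-∀
    e₁₂ : ∀ b → b * - + 1 + - + 1 * + 0 ≡ - b
    e₁₂ = solve-∀
    e₂₁ : ∀ a → + 1 * a + + 0 * + 1 ≡ a
    e₂₁ = solve-∀

  foldl-T : ∀ ys A → foldl (λ acc a → T a ⊗ acc) A ys ≡ M ys ⊗ A
  foldl-T [] A = sym (⊗-identityˡ A)
  foldl-T (y ∷ ys) A = begin
    foldl (λ acc a → T a ⊗ acc) (T y ⊗ A) ys
      ≡⟨ foldl-T ys (T y ⊗ A) ⟩
    M ys ⊗ (T y ⊗ A)
      ≡⟨ solve 3 (λ P t Q → P ∙ (t ∙ Q) ⊜ (P ∙ (t ∙ id)) ∙ Q) refl (M ys) (T y) A ⟩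
    (M ys ⊗ (T y ⊗ IdM)) ⊗ A
      ≡⟨ cong (_⊗ A) (foldl-T ys (T y ⊗ IdM)) ⟨
    M (y ∷ ys) ⊗ A
      ∎
    where open ≡-Reasoning

  M-++ : ∀ xs ys → M (xs ++ ys) ≡ M ys ⊗ M xs
  M-++ xs ys = trans (foldl-++ (λ acc a → T a ⊗ acc) IdM xs ys) (foldl-T ys (M xs))

  infix 30 T[_]^_
  T[_]^_ : ℤ → ℕ → Mat
  T[ k ]^ j = M (replicate j k)

  T^-+ : ∀ k p q → T[ k ]^ (p ℕ.+ q) ≡ T[ k ]^ q ⊗ T[ k ]^ p
  T^-+ k p q = trans (cong M (replicate-+ p q k)) (M-++ (replicate p k) (replicate q k))

  M-tup : ∀ a k j b → M (tup a k j b) ≡ T b ⊗ (T[ k ]^ j ⊗ T a)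
  M-tup a k j b = begin
    M (tup a k j b)
      ≡⟨ M-++ (a ∷ []) (replicate j k ++ b ∷ []) ⟩
    M (replicate j k ++ b ∷ []) ⊗ (T a ⊗ IdM)
      ≡⟨ cong (_⊗ (T a ⊗ IdM)) (M-++ (replicate j k) (b ∷ [])) ⟩
    ((T b ⊗ IdM) ⊗ T[ k ]^ j) ⊗ (T a ⊗ IdM)
      ≡⟨ solve 3 (λ t P s → ((t ∙ id) ∙ P) ∙ (s ∙ id) ⊜ t ∙ (P ∙ s)) refl
                 (T b) (T[ k ]^ j) (T a) ⟩
    T b ⊗ (T[ k ]^ j ⊗ T a)
      ∎
    where open ≡-Reasoning

  T^-+2 : ∀ k j → T[ k ]^ (j ℕ.+ 2) ≡ T k ⊗ (T[ k ]^ j ⊗ T k)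
  T^-+2 k j = trans (cong M (replicate-tup k j)) (M-tup k k j k)

  M-tup-+ : ∀ a k s p b → M (tup a k (s ℕ.+ p) b) ≡ T b ⊗ (T[ k ]^ p ⊗ (T[ k ]^ s ⊗ T a))
  M-tup-+ a k s p b = begin
    M (tup a k (s ℕ.+ p) b)
      ≡⟨ M-tup a k (s ℕ.+ p) b ⟩
    T b ⊗ (T[ k ]^ (s ℕ.+ p) ⊗ T a)
      ≡⟨ cong (λ X → T b ⊗ (X ⊗ T a)) (T^-+ k s p) ⟩
    T b ⊗ ((T[ k ]^ p ⊗ T[ k ]^ s) ⊗ T a)
      ≡⟨ cong (T b ⊗_) (⊗-assoc (T[ k ]^ p) (T[ k ]^ s) (T a)) ⟩
    T b ⊗ (T[ k ]^ p ⊗ (T[ k ]^ s ⊗ T a))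
      ∎
    where open ≡-Reasoning

  M-tup≡E₁₂⊗T^⊗E₂₁ : ∀ a k j b →
                     M (tup a k j b) ≡ E₁₂ (b - k) ⊗ (T[ k ]^ (j ℕ.+ 2) ⊗ E₂₁ (k - a))
  M-tup≡E₁₂⊗T^⊗E₂₁ a k j b = begin
    M (tup a k j b)
      ≡⟨ M-tup a k j b ⟩
    T b ⊗ (T[ k ]^ j ⊗ T a)
      ≡⟨ cong₂ (λ X Y → X ⊗ (T[ k ]^ j ⊗ Y)) (T≡E₁₂⊗T b k) (T≡T⊗E₂₁ a k) ⟩
    (E₁₂ (b - k) ⊗ T k) ⊗ (T[ k ]^ j ⊗ (T k ⊗ E₂₁ (k - a)))
      ≡⟨ solve 4 (λ E t P F → (E ∙ t) ∙ (P ∙ (t ∙ F)) ⊜ E ∙ ((t ∙ (P ∙ t)) ∙ F)) refl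
                 (E₁₂ (b - k)) (T k) (T[ k ]^ j) (E₂₁ (k - a)) ⟩
    E₁₂ (b - k) ⊗ ((T k ⊗ (T[ k ]^ j ⊗ T k)) ⊗ E₂₁ (k - a))
      ≡⟨ cong (λ X → E₁₂ (b - k) ⊗ (X ⊗ E₂₁ (k - a))) (T^-+2 k j) ⟨
    E₁₂ (b - k) ⊗ (T[ k ]^ (j ℕ.+ 2) ⊗ E₂₁ (k - a))
      ∎
    where open ≡-Reasoning

  M-tup≡T⊗T^⊗E₂₁ : ∀ a k j b → M (tup a k j b) ≡ T b ⊗ (T[ k ]^ (1 ℕ.+ j) ⊗ E₂₁ (k - a))
  M-tup≡T⊗T^⊗E₂₁ a k j b = begin
    M (tup a k j b)
      ≡⟨ M-tup a k j b ⟩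
    T b ⊗ (T[ k ]^ j ⊗ T a)
      ≡⟨ cong (λ X → T b ⊗ (T[ k ]^ j ⊗ X)) (T≡T⊗E₂₁ a k) ⟩
    T b ⊗ (T[ k ]^ j ⊗ (T k ⊗ E₂₁ (k - a)))
      ≡⟨ solve 4 (λ S P t F → S ∙ (P ∙ (t ∙ F)) ⊜ S ∙ ((P ∙ (t ∙ id)) ∙ F)) refl
                 (T b) (T[ k ]^ j) (T k) (E₂₁ (k - a)) ⟩
    T b ⊗ ((T[ k ]^ j ⊗ (T k ⊗ IdM)) ⊗ E₂₁ (k - a))
      ≡⟨ cong (λ X → T b ⊗ (X ⊗ E₂₁ (k - a))) (T^-+ k 1 j) ⟨
    T b ⊗ (T[ k ]^ (1 ℕ.+ j) ⊗ E₂₁ (k - a))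
      ∎
    where open ≡-Reasoning

module Modular (N : ℕ) where
  open IntegerMatrices
  open import Data.Integer using (_+_; _*_; _-_; -_)
  open Mat

  -- Congruence modulo N as in `_≡[ N ]_`, but through signed divisibility, which has the
  -- algebraic API; the record keeps both sides inferable.
  infix 4 _≋_
  record _≋_ (x y : ℤ) : Set where
    constructor mod
    field divides : + N Signed.∣ x - y

  ≋-by : ∀ {x y d} → + N Signed.∣ d → d ≡ x - y → x ≋ y
  ≋-by N∣d refl = mod N∣d

  ≋-refl : ∀ {x} → x ≋ x
  ≋-refl {x} = ≋-by (Signed.divides (+ 0) refl) (ring x)
    where
    ring : ∀ x → + 0 ≡ x - x
    ring = solve-∀

  ≋-sym : ∀ {x y} → x ≋ y → y ≋ x
  ≋-sym {x} {y} (mod p) = ≋-by (Signed.∣m⇒∣-m p) (ring x y)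
    where
    ring : ∀ x y → - (x - y) ≡ y - x
    ring = solve-∀

  ≋-trans : ∀ {x y z} → x ≋ y → y ≋ z → x ≋ z
  ≋-trans {x} {y} {z} (mod p) (mod q) = ≋-by (Signed.∣m∣n⇒∣m+n p q) (ring x y z)
    where
    ring : ∀ x y z → (x - y) + (y - z) ≡ x - z
    ring = solve-∀

  ≋-reflexive : ∀ {x y} → x ≡ y → x ≋ y
  ≋-reflexive refl = ≋-refl

  +-cong : ∀ {x x′ y y′} → x ≋ x′ → y ≋ y′ → x + y ≋ x′ + y′
  +-cong {x} {x′} {y} {y′} (mod p) (mod q) = ≋-by (Signed.∣m∣n⇒∣m+n p q) (ring x x′ y y′)
    where
    ring : ∀ x x′ y y′ → (x - x′) + (y - y′) ≡ (x + y) - (x′ + y′)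
    ring = solve-∀

  *-cong : ∀ {x x′ y y′} → x ≋ x′ → y ≋ y′ → x * y ≋ x′ * y′
  *-cong {x} {x′} {y} {y′} (mod p) (mod q) =
    ≋-by (Signed.∣m∣n⇒∣m+n (Signed.∣m⇒∣m*n y p) (Signed.∣n⇒∣m*n x′ q)) (ring x x′ y y′)
    where
    ring : ∀ x x′ y y′ → (x - x′) * y + x′ * (y - y′) ≡ x * y - x′ * y′
    ring = solve-∀

  x-y≋0⇒x≋y : ∀ {x y} → x - y ≋ + 0 → x ≋ y
  x-y≋0⇒x≋y {x} {y} (mod p) = ≋-by p (ring x y)
    where
    ring : ∀ x y → (x - y) - + 0 ≡ x - y
    ring = solve-∀

  -x≋0⇒x≋0 : ∀ {x} → - x ≋ + 0 → x ≋ + 0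
  -x≋0⇒x≋0 {x} (mod p) = ≋-by (Signed.∣m⇒∣-m p) (ring x)
    where
    ring : ∀ x → - (- x - + 0) ≡ x - + 0
    ring = solve-∀

  1≉0 : 2 ≤ N → ¬ (+ 1 ≋ + 0)
  1≉0 2≤N (mod p) = ℕ.<-irrefl (sym (ℕ.∣1⇒≡1 (Signed.∣⇒∣ᵤ p))) 2≤N

  ≋⇒≡[N] : ∀ {x y} → x ≋ y → x ≡[ N ] y
  ≋⇒≡[N] (mod p) = Signed.∣⇒∣ᵤ p

  ≡⇒≡[N] : ∀ {x y} → x ≡ y → x ≡[ N ] y
  ≡⇒≡[N] x≡y = ≋⇒≡[N] (≋-reflexive x≡y)

  ≡[N]⇒≋ : ∀ {x y} → x ≡[ N ] y → x ≋ y
  ≡[N]⇒≋ p = mod (Signed.∣ᵤ⇒∣ p)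

  infix 4 _≈_
  record _≈_ (X Y : Mat) : Set where
    constructor mat-≈
    field
      ≈₁₁ : m11 X ≋ m11 Y
      ≈₁₂ : m12 X ≋ m12 Y
      ≈₂₁ : m21 X ≋ m21 Y
      ≈₂₂ : m22 X ≋ m22 Y
  open _≈_

  ≈-refl : ∀ {X} → X ≈ X
  ≈-refl = mat-≈ ≋-refl ≋-refl ≋-refl ≋-refl

  ≈-sym : ∀ {X Y} → X ≈ Y → Y ≈ X
  ≈-sym (mat-≈ p q r s) = mat-≈ (≋-sym p) (≋-sym q) (≋-sym r) (≋-sym s)

  ≈-trans : ∀ {X Y Z} → X ≈ Y → Y ≈ Z → X ≈ Z
  ≈-trans (mat-≈ p q r s) (mat-≈ p′ q′ r′ s′) =
    mat-≈ (≋-trans p p′) (≋-trans q q′) (≋-trans r r′) (≋-trans s s′)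

  ≈-reflexive : ∀ {X Y} → X ≡ Y → X ≈ Y
  ≈-reflexive refl = ≈-refl

  ≈-setoid : Setoid _ _
  ≈-setoid = record
    { Carrier = Mat
    ; _≈_ = _≈_
    ; isEquivalence = record { refl = ≈-refl ; sym = ≈-sym ; trans = ≈-trans }
    }

  ⊗-cong : ∀ {X X′ Y Y′} → X ≈ X′ → Y ≈ Y′ → X ⊗ Y ≈ X′ ⊗ Y′
  ⊗-cong (mat-≈ a b c d) (mat-≈ e f g h) =
    mat-≈ (+-cong (*-cong a e) (*-cong b g)) (+-cong (*-cong a f) (*-cong b h))
          (+-cong (*-cong c e) (*-cong d g)) (+-cong (*-cong c f) (*-cong d h))

  T-cong : ∀ {a b} → a ≋ b → T a ≈ T b
  T-cong a≋b = mat-≈ a≋b ≋-refl ≋-refl ≋-refl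

  ≈M⇔≈ : ∀ {X Y} → X ≈M[ N ] Y ⇔ X ≈ Y
  ≈M⇔≈ = mk⇔
    (λ (p , q , r , s) → mat-≈ (≡[N]⇒≋ p) (≡[N]⇒≋ q) (≡[N]⇒≋ r) (≡[N]⇒≋ s))
    (λ (mat-≈ p q r s) → ≋⇒≡[N] p , ≋⇒≡[N] q , ≋⇒≡[N] r , ≋⇒≡[N] s)

  infix 4 _≈±Id
  _≈±Id : Mat → Set
  X ≈±Id = X ≈ IdM ⊎ X ≈ NegId

  Sol⇔≈±Id : ∀ as → Sol N as ⇔ M as ≈±Id
  Sol⇔≈±Id as = mk⇔ (Sum.map (to ≈M⇔≈) (to ≈M⇔≈)) (Sum.map (from ≈M⇔≈) (from ≈M⇔≈))

  ≈±Id-resp-≈ : ∀ {X Y} → X ≈ Y → X ≈±Id → Y ≈±Id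
  ≈±Id-resp-≈ X≈Y = Sum.map (≈-trans (≈-sym X≈Y)) (≈-trans (≈-sym X≈Y))

  ≈±Id-⊗ : ∀ {X Y} → X ≈±Id → Y ≈±Id → X ⊗ Y ≈±Id
  ≈±Id-⊗ (inj₁ p) (inj₁ q) = inj₁ (⊗-cong p q)
  ≈±Id-⊗ (inj₁ p) (inj₂ q) = inj₂ (⊗-cong p q)
  ≈±Id-⊗ (inj₂ p) (inj₁ q) = inj₂ (⊗-cong p q)
  ≈±Id-⊗ (inj₂ p) (inj₂ q) = inj₁ (⊗-cong p q)

  ≈±Id-square : ∀ {Q} → Q ≈±Id → Q ⊗ Q ≈ IdM
  ≈±Id-square (inj₁ p) = ⊗-cong p p
  ≈±Id-square (inj₂ p) = ⊗-cong p p

  ≈-resp-commute : ∀ {A Q Z} → Q ≈ Z → A ⊗ Z ≡ Z ⊗ A → A ⊗ Q ≈ Q ⊗ A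
  ≈-resp-commute {A} {Q} {Z} Q≈Z AZ≡ZA = begin
    A ⊗ Q  ≈⟨ ⊗-cong (≈-refl {A}) Q≈Z ⟩
    A ⊗ Z  ≡⟨ AZ≡ZA ⟩
    Z ⊗ A  ≈⟨ ⊗-cong (≈-sym Q≈Z) (≈-refl {A}) ⟩
    Q ⊗ A  ∎
    where open SetoidReasoning ≈-setoid

  ≈±Id-central : ∀ {Q} A → Q ≈±Id → A ⊗ Q ≈ Q ⊗ A
  ≈±Id-central A (inj₁ p) = ≈-resp-commute p (IdM-central A)
  ≈±Id-central A (inj₂ p) = ≈-resp-commute p (NegId-central A)

  ≈±Id-cancelˡ : ∀ {Q X} → Q ≈±Id → Q ⊗ X ≈±Id → X ≈±Id
  ≈±Id-cancelˡ {Q} {X} q qx = ≈±Id-resp-≈ QQX≈X (≈±Id-⊗ q qx)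
    where
    open SetoidReasoning ≈-setoid
    QQX≈X : Q ⊗ (Q ⊗ X) ≈ X
    QQX≈X = begin
      Q ⊗ (Q ⊗ X)  ≡⟨ ⊗-assoc Q Q X ⟨
      (Q ⊗ Q) ⊗ X  ≈⟨ ⊗-cong (≈±Id-square q) (≈-refl {X}) ⟩
      IdM ⊗ X      ≡⟨ ⊗-identityˡ X ⟩
      X            ∎

  ≈±Id-sandwich : ∀ {Q} A B → Q ≈±Id → A ⊗ (Q ⊗ B) ≈±Id ⇔ A ⊗ B ≈±Id
  ≈±Id-sandwich {Q} A B q =
    mk⇔ (λ h → ≈±Id-cancelˡ q (≈±Id-resp-≈ pull-out h))
        (λ h → ≈±Id-resp-≈ (≈-sym pull-out) (≈±Id-⊗ q h))
    where
    open SetoidReasoning ≈-setoid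
    pull-out : A ⊗ (Q ⊗ B) ≈ Q ⊗ (A ⊗ B)
    pull-out = begin
      A ⊗ (Q ⊗ B)  ≡⟨ ⊗-assoc A Q B ⟨
      (A ⊗ Q) ⊗ B  ≈⟨ ⊗-cong (≈±Id-central A q) (≈-refl {B}) ⟩
      (Q ⊗ A) ⊗ B  ≡⟨ ⊗-assoc Q A B ⟩
      Q ⊗ (A ⊗ B)  ∎

  ≈±Id⇒offDiagonal : ∀ {X} → X ≈±Id → m12 X ≋ + 0 × m21 X ≋ + 0
  ≈±Id⇒offDiagonal (inj₁ p) = ≈₁₂ p , ≈₂₁ p
  ≈±Id⇒offDiagonal (inj₂ p) = ≈₁₂ p , ≈₂₁ p

  T^-*-≈±Id : ∀ {k n} → T[ k ]^ n ≈±Id → ∀ m → T[ k ]^ (n ℕ.* m) ≈±Id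
  T^-*-≈±Id {k} {n} h zero = subst (λ i → T[ k ]^ i ≈±Id) (sym (ℕ.*-zeroʳ n)) (inj₁ ≈-refl)
  T^-*-≈±Id {k} {n} h (suc m) = subst (λ i → T[ k ]^ i ≈±Id) (sym (ℕ.*-suc n m))
    (≈±Id-resp-≈ (≈-reflexive (sym (T^-+ k n (n ℕ.* m)))) (≈±Id-⊗ (T^-*-≈±Id {k} {n} h m) h))

  tup-≈±Id-drop : ∀ a k s p b → T[ k ]^ p ≈±Id →
                  M (tup a k (s ℕ.+ p) b) ≈±Id ⇔ M (tup a k s b) ≈±Id
  tup-≈±Id-drop a k s p b period = begin
    M (tup a k (s ℕ.+ p) b) ≈±Id                  ≡⟨ cong _≈±Id (M-tup-+ a k s p b) ⟩
    T b ⊗ (T[ k ]^ p ⊗ (T[ k ]^ s ⊗ T a)) ≈±Id    ≈⟨ ≈±Id-sandwich (T b) (T[ k ]^ s ⊗ T a) period ⟩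
    T b ⊗ (T[ k ]^ s ⊗ T a) ≈±Id                  ≡⟨ cong _≈±Id (M-tup a k s b) ⟨
    M (tup a k s b) ≈±Id                          ∎
    where open SetoidReasoning (⇔-setoid 0ℓ)

  tup-≈±Id⇒≋k : ∀ a k j b → T[ k ]^ (j ℕ.+ 2) ≈±Id → M (tup a k j b) ≈±Id → a ≋ k × b ≋ k
  tup-≈±Id⇒≋k a k j b period sol =
    ≋-sym (x-y≋0⇒x≋y (proj₂ offDiagonal)) , x-y≋0⇒x≋y (proj₁ offDiagonal)
    where
    offDiagonal : b - k ≋ + 0 × k - a ≋ + 0
    offDiagonal = ≈±Id⇒offDiagonal
      (subst _≈±Id (E₁₂⊗E₂₁ (b - k) (k - a))
        (to (≈±Id-sandwich (E₁₂ (b - k)) (E₂₁ (k - a)) period)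
          (subst _≈±Id (M-tup≡E₁₂⊗T^⊗E₂₁ a k j b) sol)))

  tup-≉±Id : 2 ≤ N → ∀ a k j b → T[ k ]^ (1 ℕ.+ j) ≈±Id → ¬ M (tup a k j b) ≈±Id
  tup-≉±Id 2≤N a k j b period sol = 1≉0 2≤N (proj₂ (≈±Id⇒offDiagonal reduced))
    where
    reduced : mat (b - (k - a)) (- + 1) (+ 1) (+ 0) ≈±Id
    reduced =
      subst _≈±Id (T⊗E₂₁ b (k - a))
        (to (≈±Id-sandwich (T b) (E₂₁ (k - a)) period)
          (subst _≈±Id (M-tup≡T⊗T^⊗E₂₁ a k j b) sol))

  tup-≈±Id⇒≋0 : ∀ a k j b → T[ k ]^ j ≈±Id → M (tup a k j b) ≈±Id → a ≋ + 0 × b ≋ + 0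
  tup-≈±Id⇒≋0 a k j b period sol = proj₂ offDiagonal , -x≋0⇒x≋0 (proj₁ offDiagonal)
    where
    short : M (tup a k 0 b) ≈±Id
    short = to (tup-≈±Id-drop a k 0 j b period) sol
    offDiagonal : - b ≋ + 0 × a ≋ + 0
    offDiagonal = ≈±Id⇒offDiagonal
      (subst _≈±Id (trans (cong (T b ⊗_) (⊗-identityʳ (T a))) (T⊗T b a)) short)

  ≋k⇒tup-≈±Id : ∀ a k j b → a ≋ k → b ≋ k → T[ k ]^ (j ℕ.+ 2) ≈±Id →
                M (tup a k j b) ≈±Id
  ≋k⇒tup-≈±Id a k j b a≋k b≋k = ≈±Id-resp-≈ (begin
    T[ k ]^ (j ℕ.+ 2)
      ≡⟨ T^-+2 k j ⟩
    T k ⊗ (T[ k ]^ j ⊗ T k)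
      ≈⟨ ⊗-cong (T-cong (≋-sym b≋k)) (⊗-cong (≈-refl {T[ k ]^ j}) (T-cong (≋-sym a≋k))) ⟩
    T b ⊗ (T[ k ]^ j ⊗ T a)
      ≡⟨ M-tup a k j b ⟨
    M (tup a k j b)
      ∎)
    where open SetoidReasoning ≈-setoid

  ≋0⇒tup-≈±Id : ∀ a k j b → a ≋ + 0 → b ≋ + 0 → T[ k ]^ j ≈±Id → M (tup a k j b) ≈±Id
  ≋0⇒tup-≈±Id a k j b a≋0 b≋0 period =
    from (tup-≈±Id-drop a k 0 j b period)
      (inj₂ (⊗-cong (T-cong b≋0) (⊗-cong (T-cong a≋0) (≈-refl {IdM}))))

module Decomposition (N : ℕ) where
  open Modular N using (≡⇒≡[N])
  open import Data.Integer using (_+_; _-_)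

  initLast-snoc : ∀ y ys z → initLast y (ys ++ z ∷ []) ≡ (y ∷ ys , z)
  initLast-snoc y [] z = refl
  initLast-snoc y (w ∷ ws) z rewrite initLast-snoc w ws z = refl

  snoc-⊕-snoc : ∀ x ys z w us v →
    (x ∷ ys ++ z ∷ []) ⊕ (w ∷ us ++ v ∷ []) ≡ (x + v) ∷ ys ++ (z + w) ∷ us
  snoc-⊕-snoc x [] z w [] v = refl
  snoc-⊕-snoc x [] z w (u ∷ us) v rewrite initLast-snoc u us v = refl
  snoc-⊕-snoc x (y ∷ ys) z w [] v rewrite initLast-snoc y ys z = refl
  snoc-⊕-snoc x (y ∷ ys) z w (u ∷ us) v rewrite initLast-snoc y ys z | initLast-snoc u us v = refl

  length-tup : ∀ x k p y → length (tup x k p y) ≡ suc (suc p)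
  length-tup x k zero y = refl
  length-tup x k (suc p) y = cong suc (length-tup k k p y)

  replicate-reducible : ∀ a k p q → 1 ≤ p → 1 ≤ q → Sol N (tup a k q a) →
                        Reducible N (replicate (suc p ℕ.+ suc q) k)
  replicate-reducible a k p q 1≤p 1≤q sol =
    tup a k q a , tup (k - a) k p (k - a) , sol ,
    3≤length-tup (k - a) p (k - a) 1≤p , 3≤length-tup a q a 1≤q ,
    0 , inj₁ (map ≡⇒≡[N] (≡⇒Pointwise-≡ decomposition))
    where
    3≤length-tup : ∀ x r y → 1 ≤ r → 3 ≤ length (tup x k r y)
    3≤length-tup x r y 1≤r = subst (3 ≤_) (sym (length-tup x k r y)) (s≤s (s≤s 1≤r))
    k-a+a≡k : (k - a) + a ≡ k
    k-a+a≡k = ring k a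
      where
      ring : ∀ k a → (k - a) + a ≡ k
      ring = solve-∀
    decomposition : replicate (suc p ℕ.+ suc q) k ≡ (tup (k - a) k p (k - a) ⊕ tup a k q a) ++ []
    decomposition = begin
      replicate (suc p ℕ.+ suc q) k
        ≡⟨ replicate-+ (suc p) (suc q) k ⟩
      k ∷ replicate p k ++ k ∷ replicate q k
        ≡⟨ cong (λ c → c ∷ replicate p k ++ c ∷ replicate q k) k-a+a≡k ⟨
      (k - a) + a ∷ replicate p k ++ (k - a) + a ∷ replicate q k
        ≡⟨ snoc-⊕-snoc (k - a) (replicate p k) (k - a) a (replicate q k) a ⟨
      tup (k - a) k p (k - a) ⊕ tup a k q a
        ≡⟨ ++-identityʳ _ ⟨
      (tup (k - a) k p (k - a) ⊕ tup a k q a) ++ []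
        ∎
      where open ≡-Reasoning

open import Data.Nat using (_+_; _*_)
open IntegerMatrices using (T[_]^_)

SymmetricTupCriterion : ℕ → ℤ → ℕ → ℕ → ℤ → Set
SymmetricTupCriterion N k n j a =
    ((∃ λ m → j + 2 ≡ n * m) × (a ≡[ N ] k))
  ⊎ ((∃ λ m → j + 2 ≡ n * m + 2) × (a ≡[ N ] (+ 0)))

module _ {N : ℕ} {k : ℤ} {n : ℕ} (mono : IsMonoMinSize N k n) where
  open Modular N
  open Decomposition N

  T^-multiple-≈±Id : ∀ {i} m → i ≡ n * m → T[ k ]^ i ≈±Id
  T^-multiple-≈±Id m refl =
    T^-*-≈±Id {k} {n} (to (Sol⇔≈±Id (replicate n k)) (proj₁ (proj₂ mono))) m

  tup-sol-size-nm⇒≡k : ∀ m j a b → j + 2 ≡ n * m → Sol N (tup a k j b) →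
                       (a ≡[ N ] k) × (b ≡[ N ] k)
  tup-sol-size-nm⇒≡k m j a b size sol =
    Product.map ≋⇒≡[N] ≋⇒≡[N]
      (tup-≈±Id⇒≋k a k j b (T^-multiple-≈±Id m size) (to (Sol⇔≈±Id (tup a k j b)) sol))

  ¬tup-sol-size-nm+1 : 2 ≤ N → ∀ m j a b → j + 2 ≡ n * m + 1 → ¬ Sol N (tup a k j b)
  ¬tup-sol-size-nm+1 2≤N m j a b size sol =
    tup-≉±Id 2≤N a k j b
      (T^-multiple-≈±Id m (+-cancelʳ-≡ 1 (1 + j) (n * m) (trans (sym (+-suc j 1)) size)))
      (to (Sol⇔≈±Id (tup a k j b)) sol)

  tup-sol-size-nm+2⇒≡0 : ∀ m j a b → j + 2 ≡ n * m + 2 → Sol N (tup a k j b) →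
                         (a ≡[ N ] (+ 0)) × (b ≡[ N ] (+ 0))
  tup-sol-size-nm+2⇒≡0 m j a b size sol =
    Product.map ≋⇒≡[N] ≋⇒≡[N]
      (tup-≈±Id⇒≋0 a k j b (T^-multiple-≈±Id m (+-cancelʳ-≡ 2 j (n * m) size))
        (to (Sol⇔≈±Id (tup a k j b)) sol))

  criterion⇒symmetric-tup-sol : ∀ j a → SymmetricTupCriterion N k n j a → Sol N (tup a k j a)
  criterion⇒symmetric-tup-sol j a (inj₁ ((m , size) , a≡k)) =
    from (Sol⇔≈±Id (tup a k j a))
      (≋k⇒tup-≈±Id a k j a (≡[N]⇒≋ a≡k) (≡[N]⇒≋ a≡k) (T^-multiple-≈±Id m size))
  criterion⇒symmetric-tup-sol j a (inj₂ ((m , size) , a≡0)) =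
    from (Sol⇔≈±Id (tup a k j a))
      (≋0⇒tup-≈±Id a k j a (≡[N]⇒≋ a≡0) (≡[N]⇒≋ a≡0)
        (T^-multiple-≈±Id m (+-cancelʳ-≡ 2 j (n * m) size)))

  tup-sol-drop-periods : ∀ q s a b → Sol N (tup a k (s + n * q) b) → Sol N (tup a k s b)
  tup-sol-drop-periods q s a b sol =
    from (Sol⇔≈±Id (tup a k s b))
      (to (tup-≈±Id-drop a k s (n * q) b (T^-multiple-≈±Id q refl))
        (to (Sol⇔≈±Id (tup a k (s + n * q) b)) sol))

  ¬short-symmetric-tup-sol : Irreducible N (replicate n k) →
                             ∀ a s → 1 ≤ s → 2 + s < n → ¬ Sol N (tup a k s a)
  ¬short-symmetric-tup-sol irr a s 1≤s 2+s<n sol =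
    let o , size = m≤n⇒∃[o]m+o≡n 2+s<n
    in proj₂ (proj₂ irr) (subst (λ i → Reducible N (replicate i k)) (trans (arith o s) size)
         (replicate-reducible a k (suc o) s (s≤s z≤n) 1≤s sol))
    where
    arith : ∀ o s → suc (suc o) + suc s ≡ suc (2 + s) + o
    arith = ℕ-Solver.solve-∀

  symmetric-tup-sol⇒criterion : 2 ≤ N → Irreducible N (replicate n k) →
                                ∀ j a → Sol N (tup a k j a) → SymmetricTupCriterion N k n j a
  symmetric-tup-sol⇒criterion 2≤N irr j a sol =
    by-residue ((j + 2) % n) ((j + 2) / n) (m≡m%n+[m/n]*n (j + 2) n) (m%n<n (j + 2) n)
    where
    instance
      n≢0 : NonZero n
      n≢0 = >-nonZero (proj₁ mono)
    swap : ∀ r q → r + q * n ≡ n * q + r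
    swap r q = trans (+-comm r (q * n)) (cong (_+ r) (*-comm q n))
    by-residue : ∀ r q → j + 2 ≡ r + q * n → r < n → SymmetricTupCriterion N k n j a
    by-residue 0 q size _ =
      let size′ = trans size (*-comm q n)
      in inj₁ ((q , size′) , proj₁ (tup-sol-size-nm⇒≡k q j a a size′ sol))
    by-residue 1 q size _ = ⊥-elim (¬tup-sol-size-nm+1 2≤N q j a a (trans size (swap 1 q)) sol)
    by-residue 2 q size _ =
      let size′ = trans size (swap 2 q)
      in inj₂ ((q , size′) , proj₁ (tup-sol-size-nm+2⇒≡0 q j a a size′ sol))
    by-residue (suc (suc (suc s))) q size r<n =
      ⊥-elim (¬short-symmetric-tup-sol irr a (suc s) (s≤s z≤n) r<n
        (tup-sol-drop-periods q (suc s) a a (subst (λ i → Sol N (tup a k i a)) j≡ sol)))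
      where
      j≡ : j ≡ suc s + n * q
      j≡ = +-cancelʳ-≡ 2 j (suc s + n * q) (trans size (arith s q n))
        where
        arith : ∀ s q n → suc (suc (suc s)) + q * n ≡ (suc s + n * q) + 2
        arith = ℕ-Solver.solve-∀

mainTheorem5 : (N : ℕ) → 2 ≤ N → (k : ℤ) (n : ℕ) → IsMonoMinSize N k n →
    ((m j : ℕ) (a b : ℤ) →
        (j + 2 ≡ n * m → Sol N (tup a k j b) → (a ≡[ N ] k) × (b ≡[ N ] k))
      × (j + 2 ≡ n * m + 1 → ¬ Sol N (tup a k j b))
      × (j + 2 ≡ n * m + 2 → Sol N (tup a k j b) → (a ≡[ N ] (+ 0)) × (b ≡[ N ] (+ 0))))
    × (Irreducible N (replicate n k) →
        (j : ℕ) (a : ℤ) →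
          (Sol N (tup a k j a) →
              ((∃ λ m → j + 2 ≡ n * m) × (a ≡[ N ] k))
            ⊎ ((∃ λ m → j + 2 ≡ n * m + 2) × (a ≡[ N ] (+ 0))))
        × (((∃ λ m → j + 2 ≡ n * m) × (a ≡[ N ] k))
            ⊎ ((∃ λ m → j + 2 ≡ n * m + 2) × (a ≡[ N ] (+ 0)))
           → Sol N (tup a k j a)))
mainTheorem5 N 2≤N k n mono =
  (λ m j a b → tup-sol-size-nm⇒≡k mono m j a b
             , ¬tup-sol-size-nm+1 mono 2≤N m j a b
             , tup-sol-size-nm+2⇒≡0 mono m j a b) ,
  (λ irr j a → symmetric-tup-sol⇒criterion mono 2≤N irr j a , criterion⇒symmetric-tup-sol mono j a)
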